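{- Let $(a_i)_{i=1}^n$ be a sequence of integers such that $a_1 \geq 2$ and $a_{i+1} \geq a_i^2 - a_i + 1$ for all $i = 1,\ldots,n-1$. Then $(a_i)_{i=1}^n$ is the $n$-term greedy underapproximation sequence of the real number $\theta$ if and only if \[ \theta \in \left( \sum_{i=1}^n \frac{1}{a_i},\ \sum_{i=1}^{n-1} \frac{1}{a_i} + \frac{1}{a_n - 1} \right]. \]
   Context: For $\theta \in (0,1]$ let $G(\theta) = \lfloor 1/\theta \rfloor + 1$; equivalently $G(\theta)$ is the unique integer $a \geq 2$ with $1/a < \theta \leq 1/(a-1)$. The greedy underapproximation algorithm applied to $\theta$ produces $a_1 = G(\theta)$ and $a_{i+1} = G\left(\theta - \sum_{j=1}^i \frac{1}{a_j}\right)$ for $i \geq 1$; the first $n$ terms $(a_i)_{i=1}^n$ form the $n$-term greedy underapproximation sequence of $\theta$. Equivalently, $(a_i)_{i=1}^n$ is the $n$-term greedy underapproximation sequence of $\theta$ iff for each $k=1,\dots,n$ one has $\frac{1}{a_k} < \theta - \sum_{i=1}^{k-1}\frac{1}{a_i} \leq \frac{1}{a_k - 1}$. -}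

module Defs where

open import Data.Nat as ℕ using (ℕ; zero; suc)
open import Data.Integer using (+_)
open import Data.Rational using (ℚ; 0ℚ; _/_; _+_; _<_)
open import Data.Product using (_×_)
open import Data.Sum using (_⊎_)
open import Relation.Nullary using (¬_)

-- Real numbers as (one-sided) Dedekind cuts: a real θ is given by its
-- lower cut  lower q  ⇔  q < θ  (q rational).
record ℝ : Set₁ where
  field
    lower        : ℚ → Set
    inhabited    : Data.Product.Σ ℚ lower
    bounded      : Data.Product.Σ ℚ (λ q → ¬ lower q)
    downClosed   : ∀ {p q} → p < q → lower q → lower p
    rounded      : ∀ {q} → lower q → Data.Product.Σ ℚ (λ r → q < r × lower r)
    located      : ∀ {p q} → p < q → lower p ⊎ ¬ lower q
open ℝ public

_<ʳ_ : ℚ → ℝ → Set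
q <ʳ θ = lower θ q

_≥ʳ_ : ℚ → ℝ → Set
q ≥ʳ θ = ¬ lower θ q

-- 1/a as a rational (the value at a = 0 is irrelevant: it never occurs)
inv : ℕ → ℚ
inv zero    = 0ℚ
inv (suc k) = + 1 / suc k

-- partial sums  S a k = Σ_{i=1}^{k} 1/a_i   (sequence indexed from 1)
S : (ℕ → ℕ) → ℕ → ℚ
S a zero    = 0ℚ
S a (suc k) = S a k + inv (a (suc k))

IsGreedySeq : ℕ → (ℕ → ℕ) → ℝ → Set
IsGreedySeq n a θ =
  ∀ k → 1 ℕ.≤ k → k ℕ.≤ n →
    (S a (k ℕ.∸ 1) + inv (a k)) <ʳ θ × (S a (k ℕ.∸ 1) + inv (a k ℕ.∸ 1)) ≥ʳ θ

-- The endpoints of the greedy intervals are monotone: S_k = Σ_{i≤k} 1/a_i increases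
-- with k, while S_{k-1} + 1/(a_k − 1) decreases with k as long as
-- 1/a_k + 1/(a_{k+1} − 1) ≤ 1/(a_k − 1), i.e. a_{k+1} − 1 ≥ a_k (a_k − 1), which is
-- exactly the growth hypothesis. Hence the k-th greedy interval contains the n-th one
-- for every k ≤ n, and θ lies in all of them as soon as it lies in the last one.
module Submission where

open import Defs
open import Data.Nat using (ℕ; zero; suc; _≤_; _<_; _*_; _∸_; _+_; z≤n; s≤s; _≤′_; ≤′-refl; ≤′-step)
open import Data.Nat.Properties as ℕ
  using (≤⇒≤′; <⇒≤; *-distribˡ-∸; *-identityʳ; m+n≤o⇒m≤o∸n; +-monoʳ-≤; module ≤-Reasoning)
open import Data.Nat.Tactic.RingSolver using (solve)
open import Data.List using (_∷_; [])
open import Data.Integer using (+_; +≤+)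
open import Data.Rational as ℚ using (ℚ; 0ℚ; toℚᵘ) renaming (_+_ to _+ℚ_)
open import Data.Rational.Properties as ℚ
  using (toℚᵘ-fromℚᵘ; toℚᵘ-homo-+; toℚᵘ-cancel-≤; nonNegative⁻¹; normalize-nonNeg)
open import Data.Rational.Unnormalised as ℚᵘ using (mkℚᵘ; *≤*)
import Data.Rational.Unnormalised.Properties as ℚᵘ
open import Data.Product using (_×_; _,_)
open import Function.Base using (_∘_)
open import Function.Bundles using (_⇔_; mk⇔)
open import Relation.Binary.Core using (Rel)
open import Relation.Binary.Structures using (IsPreorder)
import Relation.Binary.Construct.Flip.EqAndOrd as Flip
open import Relation.Binary.PropositionalEquality using (_≡_; sym; trans; cong)

stepwise-monotone : ∀ {c ℓ₁ ℓ₂} {A : Set c} {_≈_ : Rel A ℓ₁} {_∼_ : Rel A ℓ₂} →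
  IsPreorder _≈_ _∼_ → ∀ {n} (f : ℕ → A) → (∀ i → i < n → f i ∼ f (suc i)) →
  ∀ {j k} → j ≤ k → k ≤ n → f j ∼ f k
stepwise-monotone {_∼_ = _∼_} pre {n} f step {j} j≤k = go (≤⇒≤′ j≤k)
  where
  open IsPreorder pre using () renaming (refl to ∼-refl; trans to ∼-trans)
  go : ∀ {k} → j ≤′ k → k ≤ n → f j ∼ f k
  go ≤′-refl        _   = ∼-refl
  go (≤′-step j≤′k) k<n = ∼-trans (go j≤′k (<⇒≤ k<n)) (step _ k<n)

m*m∸m≡m*[m∸1] : ∀ m → m * m ∸ m ≡ m * (m ∸ 1)
m*m∸m≡m*[m∸1] m = trans (cong (m * m ∸_) (sym (*-identityʳ m))) (sym (*-distribˡ-∸ m m 1))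

m≤m*m∸m+1 : ∀ m → m ≤ m * m ∸ m + 1
m≤m*m∸m+1 zero    = z≤n
m≤m*m∸m+1 (suc m) = begin
  suc m                    ≡⟨ ℕ.+-comm 1 m ⟩
  m + 1                    ≤⟨ ℕ.+-monoˡ-≤ 1 (ℕ.m≤m+n m (m * m)) ⟩
  suc m * m + 1            ≡⟨ cong (_+ 1) (sym (m*m∸m≡m*[m∸1] (suc m))) ⟩
  suc m * suc m ∸ suc m + 1 ∎
  where open ≤-Reasoning

-- 1/(m+2) + 1/(c+1) ≤ 1/(m+1), cross-multiplied exactly as ℚᵘ._≤_ unfolds (hence the factors 1 *).
reciprocal-sum-≤ᵘ : ∀ m c → suc (suc m) * suc m ≤ suc c →
  mkℚᵘ (+ 1) (suc m) ℚᵘ.+ mkℚᵘ (+ 1) c ℚᵘ.≤ mkℚᵘ (+ 1) m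
reciprocal-sum-≤ᵘ m c h = *≤* (+≤+ (begin
  (1 * suc c + 1 * suc (suc m)) * suc m ≡⟨ solve (m ∷ c ∷ []) ⟩
  suc c * suc m + suc (suc m) * suc m   ≤⟨ +-monoʳ-≤ (suc c * suc m) h ⟩
  suc c * suc m + suc c                 ≡⟨ solve (m ∷ c ∷ []) ⟩
  1 * (suc (suc m) * suc c)             ∎))
  where open ≤-Reasoning

toℚᵘ-inv-suc : ∀ k → toℚᵘ (inv (suc k)) ℚᵘ.≃ mkℚᵘ (+ 1) k
toℚᵘ-inv-suc k = toℚᵘ-fromℚᵘ (mkℚᵘ (+ 1) k)

inv-+-inv-≤-inv-pred : ∀ {x y} → 2 ≤ x → x * (x ∸ 1) ≤ y → inv x +ℚ inv y ℚ.≤ inv (x ∸ 1)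
inv-+-inv-≤-inv-pred {suc (suc m)} {suc c} _ h = toℚᵘ-cancel-≤ (begin
  toℚᵘ (inv (suc (suc m)) +ℚ inv (suc c))           ≃⟨ toℚᵘ-homo-+ (inv (suc (suc m))) (inv (suc c)) ⟩
  toℚᵘ (inv (suc (suc m))) ℚᵘ.+ toℚᵘ (inv (suc c)) ≃⟨ ℚᵘ.+-cong (toℚᵘ-inv-suc (suc m)) (toℚᵘ-inv-suc c) ⟩
  mkℚᵘ (+ 1) (suc m) ℚᵘ.+ mkℚᵘ (+ 1) c             ≤⟨ reciprocal-sum-≤ᵘ m c h ⟩
  mkℚᵘ (+ 1) m                                     ≃⟨ toℚᵘ-inv-suc m ⟨
  toℚᵘ (inv (suc m))                               ∎)
  where open ℚᵘ.≤-Reasoning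
inv-+-inv-≤-inv-pred {suc zero}    (s≤s ())
inv-+-inv-≤-inv-pred {suc (suc m)} {zero} _ ()

inv-nonNeg : ∀ x → 0ℚ ℚ.≤ inv x
inv-nonNeg zero    = ℚ.≤-refl
inv-nonNeg (suc k) = nonNegative⁻¹ (inv (suc k)) {{normalize-nonNeg 1 (suc k)}}

S-step : ∀ a k → S a k ℚ.≤ S a (suc k)
S-step a k = begin
  S a k                     ≡⟨ ℚ.+-identityʳ (S a k) ⟨
  S a k +ℚ 0ℚ               ≤⟨ ℚ.+-monoʳ-≤ (S a k) (inv-nonNeg (a (suc k))) ⟩
  S a k +ℚ inv (a (suc k))  ∎
  where open ℚ.≤-Reasoning

S-mono : ∀ a {j k} → j ≤ k → S a j ℚ.≤ S a k
S-mono a j≤k = stepwise-monotone ℚ.≤-isPreorder (S a) (λ i _ → S-step a i) j≤k ℕ.≤-refl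

S⁺ : (ℕ → ℕ) → ℕ → ℚ
S⁺ a k = S a k +ℚ inv (a (suc k) ∸ 1)

≤-<ʳ-trans : ∀ {p q} {θ : ℝ} → p ℚ.≤ q → q <ʳ θ → p <ʳ θ
≤-<ʳ-trans {θ = θ} p≤q q<θ with rounded θ q<θ
... | r , q<r , r<θ = downClosed θ (ℚ.≤-<-trans p≤q q<r) r<θ

≥-≥ʳ-trans : ∀ {p q} {θ : ℝ} → q ℚ.≤ p → q ≥ʳ θ → p ≥ʳ θ
≥-≥ʳ-trans {θ = θ} q≤p q≥θ p<θ = q≥θ (≤-<ʳ-trans {θ = θ} q≤p p<θ)

module _ {n : ℕ} (a : ℕ → ℕ) (a₁≥2 : 2 ≤ a 1)
  (growth : ∀ i → 1 ≤ i → suc i ≤ suc n → a i * a i ∸ a i + 1 ≤ a (suc i)) where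

  a≥2 : ∀ {k} → k ≤ n → 2 ≤ a (suc k)
  a≥2 k≤n = ℕ.≤-trans a₁≥2 (stepwise-monotone ℕ.≤-isPreorder (a ∘ suc) a-step z≤n k≤n)
    where
    a-step : ∀ i → i < n → a (suc i) ≤ a (suc (suc i))
    a-step i i<n = ℕ.≤-trans (m≤m*m∸m+1 (a (suc i))) (growth (suc i) (s≤s z≤n) (s≤s i<n))

  S⁺-step : ∀ i → i < n → S⁺ a (suc i) ℚ.≤ S⁺ a i
  S⁺-step i i<n = begin
    S a i +ℚ inv x +ℚ inv (y ∸ 1)    ≡⟨ ℚ.+-assoc (S a i) (inv x) (inv (y ∸ 1)) ⟩
    S a i +ℚ (inv x +ℚ inv (y ∸ 1))  ≤⟨ ℚ.+-monoʳ-≤ (S a i) (inv-+-inv-≤-inv-pred (a≥2 (<⇒≤ i<n)) x[x∸1]≤y∸1) ⟩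
    S a i +ℚ inv (x ∸ 1)             ∎
    where
    open ℚ.≤-Reasoning
    x y : ℕ
    x = a (suc i)
    y = a (suc (suc i))
    x[x∸1]≤y∸1 : x * (x ∸ 1) ≤ y ∸ 1
    x[x∸1]≤y∸1 rewrite sym (m*m∸m≡m*[m∸1] x) = m+n≤o⇒m≤o∸n _ (growth (suc i) (s≤s z≤n) (s≤s i<n))

  S⁺-antitone : ∀ {j k} → j ≤ k → k ≤ n → S⁺ a k ℚ.≤ S⁺ a j
  S⁺-antitone = stepwise-monotone (Flip.isPreorder ℚ.≤-isPreorder) (S⁺ a) S⁺-step

theorem2p1 : (n : ℕ) → 1 ≤ n → (a : ℕ → ℕ) → 2 ≤ a 1 →
    (∀ i → 1 ≤ i → suc i ≤ n → a i * a i ∸ a i + 1 ≤ a (suc i)) →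
    (θ : ℝ) →
    IsGreedySeq n a θ ⇔ (S a n <ʳ θ × (S a (n ∸ 1) +ℚ inv (a n ∸ 1)) ≥ʳ θ)
theorem2p1 (suc n) _ a a₁≥2 growth θ = mk⇔ (λ greedy → greedy (suc n) (s≤s z≤n) ℕ.≤-refl) last⇒greedy
  where
  last⇒greedy : S a (suc n) <ʳ θ × S⁺ a n ≥ʳ θ → IsGreedySeq (suc n) a θ
  last⇒greedy (Sₙ<θ , S⁺ₙ≥θ) (suc k) _ (s≤s k≤n) =
      ≤-<ʳ-trans {θ = θ} (S-mono a (s≤s k≤n)) Sₙ<θ
    , ≥-≥ʳ-trans {θ = θ} (S⁺-antitone a a₁≥2 growth k≤n ℕ.≤-refl) S⁺ₙ≥θ
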